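{- Let $G$ be a connected graph of order $n\geq 2$ with diameter $d$, and let $k$ be an integer. If $V_1=\emptyset$ and $n\geq k(d-1)+1$, then $m(-1)\leq n-k-1$.
   Context: For a connected graph $G$, $d(u,v)$ is the distance and $\varepsilon(v)=\max_{u} d(u,v)$ the eccentricity of $v$; $V_i=\{v\in V(G):\varepsilon(v)=i\}$; the diameter is the maximum distance. The eccentricity matrix $\mathcal{A}(G)$ is indexed by $V(G)$ with $(u,v)$-entry $d(u,v)$ if $d(u,v)=\min\{\varepsilon(u),\varepsilon(v)\}$ and $0$ otherwise. $m(-1)$ is the multiplicity of $-1$ as an eigenvalue of $\mathcal{A}(G)$. -}

module Defs where

open import Data.Bool using (Bool; true; false; _∧_; _∨_; not; T; if_then_else_)
open import Data.Nat using (ℕ; zero; suc; _⊔_; _⊓_; _≟_)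
open import Data.Fin using (Fin)
open import Data.Fin.Properties using () renaming (_≟_ to _≟F_)
open import Data.List using (List; foldr; map; upTo; length; filter)
open import Data.Bool.ListAction using (any)
open import Data.List using () renaming (allFin to allFinL)
open import Data.Product using (Σ; ∃; ∃-syntax; _×_)
open import Data.Rational using (ℚ; 0ℚ; _+_; _*_)
import Data.Integer
open import Relation.Binary.PropositionalEquality using (_≡_; _≢_)
open import Relation.Nullary using (¬_)
open import Relation.Nullary.Decidable using (⌊_⌋)

record Graph (n : ℕ) : Set where
  field
    adj   : Fin n → Fin n → Bool
    sym   : ∀ u v → adj u v ≡ adj v u
    irrefl : ∀ u → adj u u ≡ false

module _ {n : ℕ} (G : Graph n) where
  open Graph G

  reach : ℕ → Fin n → Fin n → Bool
  reach zero    u v = ⌊ u ≟F v ⌋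
  reach (suc l) u v = reach l u v ∨ any (λ w → reach l u w ∧ adj w v) (allFinL n)

  Connected : Set
  Connected = ∀ u v → ∃[ l ] T (reach l u v)

  -- distance d(u,v) = least l with a walk of length ≤ l, i.e. the number of
  -- l ∈ {0,…,n-1} for which v is not reachable from u within l steps
  -- (in a connected graph on n vertices every distance is ≤ n-1).
  dist : Fin n → Fin n → ℕ
  dist u v = length (filter (λ l → Relation.Nullary.Decidable.¬? (Data.Bool._≟_ (reach l u v) true)) (upTo n))

  maxOver : (Fin n → ℕ) → ℕ
  maxOver f = foldr (λ w m → f w ⊔ m) 0 (allFinL n)

  ecc : Fin n → ℕ
  ecc v = maxOver (λ u → dist u v)

  diameter : ℕ
  diameter = maxOver ecc

  eccMatrix : Fin n → Fin n → ℚ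
  eccMatrix u v = if ⌊ dist u v ≟ (ecc u ⊓ ecc v) ⌋ then (Data.Integer.+_ (dist u v) Data.Rational./ 1) else 0ℚ

sumℚ : ∀ {n} → (Fin n → ℚ) → ℚ
sumℚ {n} f = foldr (λ i s → f i + s) 0ℚ (allFinL n)

InEigenspace-1 : ∀ {n} → (Fin n → Fin n → ℚ) → (Fin n → ℚ) → Set
InEigenspace-1 {n} M x = ∀ u → sumℚ (λ v → M u v * x v) + x u ≡ 0ℚ

LinIndep : ∀ {n t} → (Fin t → Fin n → ℚ) → Set
LinIndep {n} {t} xs = ∀ (c : Fin t → ℚ) → (∀ u → sumℚ (λ i → c i * xs i u) ≡ 0ℚ) → ∀ i → c i ≡ 0ℚ

-- the (-1)-eigenspace of M contains t linearly independent vectors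
-- (so m(-1) = dim of that eigenspace = max such t; M symmetric real, so geometric = algebraic multiplicity)
Eig-1-Independent : ∀ {n} → (Fin n → Fin n → ℚ) → ℕ → Set
Eig-1-Independent {n} M t = Σ (Fin t → Fin n → ℚ) λ xs → LinIndep xs × (∀ i → InEigenspace-1 M (xs i))

module Submission where

-- Let e ≥ 2 be an eccentricity. On Vₑ × Vₑ the eccentricity matrix is e·B for a 0/1 matrix B,
-- so a (-1)-eigenvector y supported on Vₑ satisfies y = -e·By. After clearing denominators this
-- makes every entry of y divisible by every power of e, so y = 0. Hence the (-1)-eigenspace meets
-- the coordinate subspace of Vₑ trivially and m(-1) ≤ n - |Vₑ|. All eccentricities lie in
-- {2, …, d}, so n > k(d-1) forces, by pigeonhole, a class with |Vₑ| ≥ k + 1.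

open import Defs
open import Algebra.Bundles using (CommutativeRing)
import Algebra.Properties.Group as GroupProperties
import Algebra.Properties.Semiring.Sum as SemiringSum
open import Data.Fin using (Fin; zero; suc; punchIn; punchOut)
open import Data.Fin.Properties using (all?; ¬∀⟶∃¬; punchIn-punchOut; punchInᵢ≢i)
import Data.Fin.Properties as Fin
open import Data.Integer as ℤ using (ℤ; +_; 0ℤ)
import Data.Integer.Properties as ℤ
open import Data.Integer.Solver using () renaming (module +-*-Solver to ℤ-Solver)
open import Data.List using (List; []; _∷_; foldr; tabulate; length; lookup; filter; allFin)
import Data.List.Properties as List
open import Data.List.Membership.Propositional using (_∈_)
open import Data.List.Membership.Propositional.Properties using (∈-allFin; ∈-filter⁺; ∈-filter⁻)
open import Data.List.Relation.Binary.Sublist.Propositional.Properties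
  using (filter⁺; filter-⊆; length-mono-≤)
open import Data.List.Relation.Unary.Any using (here; there; index)
open import Data.List.Relation.Unary.Any.Properties using (lookup-index)
open import Data.Nat as ℕ using (ℕ; zero; suc; _^_; _⊔_; _⊓_; _≟_)
import Data.Nat.Divisibility as ℕ
import Data.Nat.Properties as ℕ
open import Data.Product using (∃; ∃₂; _×_; _,_; proj₁; proj₂)
open import Data.Rational as ℚ using (ℚ; 0ℚ; 1ℚ; _+_; _-_; _*_; -_; _÷_; 1/_; ↥_; ↧ₙ_)
open import Data.Rational.Literals using (fromℤ)
import Data.Rational.Properties as ℚ
open import Data.Rational.Solver using (module +-*-Solver)
import Data.Rational.Unnormalised as ℚᵘ
import Data.Rational.Unnormalised.Properties as ℚᵘ
open import Function using (_∘_; id)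
open import Relation.Binary.PropositionalEquality
open import Relation.Nullary using (Dec; yes; no; ¬?)
open import Relation.Nullary.Negation using (contradiction)
open import Relation.Unary using (Pred; Decidable)

open SemiringSum (CommutativeRing.semiring ℚ.+-*-commutativeRing)
  using (sum; sum-cong-≗; sum-replicate-zero; ∑-comm; ∑-distrib-+; *-distribˡ-sum)
module ℤ∑ = SemiringSum ℤ.+-*-semiring

private
  variable
    m n t : ℕ

foldr-tabulate : (f : Fin m → ℚ) (g : Fin n → Fin m) →
                 foldr (λ i s → f i + s) 0ℚ (tabulate g) ≡ sum (f ∘ g)
foldr-tabulate {n = zero}  f g = refl
foldr-tabulate {n = suc n} f g = cong (_+_ (f (g zero))) (foldr-tabulate f (g ∘ suc))

sumℚ≡sum : (f : Fin n → ℚ) → sumℚ f ≡ sum f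
sumℚ≡sum f = foldr-tabulate f id

-- On integers, ℚ's _+_ and _*_ unfold to (a * 1 + b * 1) / 1 and (a * b) / 1.
fromℤ-+ : ∀ a b → fromℤ (a ℤ.+ b) ≡ fromℤ a + fromℤ b
fromℤ-+ a b = sym (trans (cong₂ (λ x y → (x ℤ.+ y) ℚ./ 1) (ℤ.*-identityʳ a) (ℤ.*-identityʳ b))
                         (ℚ.↥p/↧p≡p (fromℤ (a ℤ.+ b))))

fromℤ-* : ∀ a b → fromℤ (a ℤ.* b) ≡ fromℤ a * fromℤ b
fromℤ-* a b = sym (ℚ.↥p/↧p≡p (fromℤ (a ℤ.* b)))

fromℤ-neg : ∀ a → fromℤ (ℤ.- a) ≡ - fromℤ a
fromℤ-neg (+ zero)    = refl
fromℤ-neg (+ suc _)   = refl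
fromℤ-neg ℤ.-[1+ _ ]  = refl

fromℤ-sum : (f : Fin n → ℤ) → fromℤ (ℤ∑.sum f) ≡ sum (fromℤ ∘ f)
fromℤ-sum {zero}  f = refl
fromℤ-sum {suc n} f = trans (fromℤ-+ (f zero) _) (cong (_+_ (fromℤ (f zero))) (fromℤ-sum (f ∘ suc)))

fromℤ-injective : ∀ {a b} → fromℤ a ≡ fromℤ b → a ≡ b
fromℤ-injective = cong ↥_

lincomb : (Fin t → Fin m → ℚ) → (Fin t → ℚ) → Fin m → ℚ
lincomb xs c u = sum λ i → c i * xs i u

NontrivialRelation : (Fin t → Fin m → ℚ) → Set
NontrivialRelation xs = ∃ λ c → (∃ λ i → c i ≢ 0ℚ) × (∀ u → lincomb xs c u ≡ 0ℚ)

module Elimination (xs : Fin (suc t) → Fin (suc m) → ℚ) (j : Fin (suc m))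
                   (pivot≢0 : xs zero j ≢ 0ℚ) where

  private instance
    pivot-nonZero : ℚ.NonZero (xs zero j)
    pivot-nonZero = ℚ.≢-nonZero pivot≢0

  ratio : Fin t → ℚ
  ratio i = xs (suc i) j ÷ xs zero j

  reduced : Fin t → Fin (suc m) → ℚ
  reduced i u = xs (suc i) u - ratio i * xs zero u

  reduced-pivot : ∀ i → reduced i j ≡ 0ℚ
  reduced-pivot i = begin
    x - x * 1/ p * p    ≡⟨ cong (λ z → x - z) (trans (ℚ.*-assoc x (1/ p) p)
                             (trans (cong (x *_) (ℚ.*-inverseˡ p)) (ℚ.*-identityʳ x))) ⟩
    x - x               ≡⟨ ℚ.+-inverseʳ x ⟩
    0ℚ                  ∎
    where
    open ≡-Reasoning
    x = xs (suc i) j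
    p = xs zero j

  extend : (Fin t → ℚ) → Fin (suc t) → ℚ
  extend c zero    = - sum (λ i → c i * ratio i)
  extend c (suc i) = c i

  lincomb-reduced : ∀ c u → lincomb reduced c u ≡ lincomb xs (extend c) u
  lincomb-reduced c u = begin
    sum (λ i → c i * (xs (suc i) u - ratio i * x₀))
      ≡⟨ sum-cong-≗ (λ i → solve 4 (λ a b q z → a :* (b :- q :* z) := a :* b :+ (:- z) :* (a :* q))
                                  refl (c i) (xs (suc i) u) (ratio i) x₀) ⟩
    sum (λ i → c i * xs (suc i) u + - x₀ * (c i * ratio i))
      ≡⟨ ∑-distrib-+ (λ i → c i * xs (suc i) u) (λ i → - x₀ * (c i * ratio i)) ⟩
    sum (λ i → c i * xs (suc i) u) + sum (λ i → - x₀ * (c i * ratio i))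
      ≡⟨ cong (_+_ (sum (λ i → c i * xs (suc i) u))) (sym (*-distribˡ-sum (- x₀) (λ i → c i * ratio i))) ⟩
    sum (λ i → c i * xs (suc i) u) + - x₀ * sum (λ i → c i * ratio i)
      ≡⟨ solve 3 (λ a z s → a :+ (:- z) :* s := (:- s) :* z :+ a) refl
                 (sum (λ i → c i * xs (suc i) u)) x₀ (sum (λ i → c i * ratio i)) ⟩
    lincomb xs (extend c) u ∎
    where
    open ≡-Reasoning
    open +-*-Solver
    x₀ = xs zero u

  lift-relation : NontrivialRelation (λ i → reduced i ∘ punchIn j) → NontrivialRelation xs
  lift-relation (c , (i , cᵢ≢0) , vanishes) = extend c , (suc i , cᵢ≢0) , vanishes′
    where
    vanishes′ : ∀ u → lincomb xs (extend c) u ≡ 0ℚ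
    vanishes′ u with j Fin.≟ u
    ... | yes refl = begin
      lincomb xs (extend c) j       ≡⟨ sym (lincomb-reduced c j) ⟩
      sum (λ i → c i * reduced i j) ≡⟨ sum-cong-≗ (λ i → trans (cong (c i *_) (reduced-pivot i)) (ℚ.*-zeroʳ (c i))) ⟩
      sum {t} (λ _ → 0ℚ)            ≡⟨ sum-replicate-zero t ⟩
      0ℚ                            ∎
      where open ≡-Reasoning
    ... | no j≢u = begin
      lincomb xs (extend c) u                        ≡⟨ sym (lincomb-reduced c u) ⟩
      lincomb reduced c u                            ≡⟨ cong (lincomb reduced c) (sym (punchIn-punchOut j≢u)) ⟩
      lincomb reduced c (punchIn j (punchOut j≢u))   ≡⟨ vanishes (punchOut j≢u) ⟩
      0ℚ                                             ∎
      where open ≡-Reasoning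

-- Either the first vector is zero, or it is eliminated from the others at a pivot coordinate,
-- leaving one vector and one coordinate fewer.
m<t⇒nontrivialRelation : m ℕ.< t → (xs : Fin t → Fin m → ℚ) → NontrivialRelation xs
m<t⇒nontrivialRelation {m} {suc t} m<t xs with all? (λ u → xs zero u ℚ.≟ 0ℚ)
... | yes x₀≡0 = unit , (zero , ℚ.1≢0) , vanishes
  where
  unit : Fin (suc t) → ℚ
  unit zero    = 1ℚ
  unit (suc _) = 0ℚ
  vanishes : ∀ u → lincomb xs unit u ≡ 0ℚ
  vanishes u = cong₂ _+_ (trans (ℚ.*-identityˡ _) (x₀≡0 u))
                         (trans (sum-cong-≗ (λ i → ℚ.*-zeroˡ (xs (suc i) u))) (sum-replicate-zero t))
... | no x₀≢0 with ¬∀⟶∃¬ m _ (λ u → xs zero u ℚ.≟ 0ℚ) x₀≢0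
m<t⇒nontrivialRelation {suc m} {suc t} m<t xs | no _ | j , pivot≢0 =
  lift-relation (m<t⇒nontrivialRelation (ℕ.≤-pred m<t) (λ i → reduced i ∘ punchIn j))
  where open Elimination xs j pivot≢0

nontrivialRelationOn : (L : List (Fin n)) → length L ℕ.< t → (xs : Fin t → Fin n → ℚ) →
                       ∃ λ c → (∃ λ i → c i ≢ 0ℚ) × (∀ {u} → u ∈ L → lincomb xs c u ≡ 0ℚ)
nontrivialRelationOn L L<t xs with m<t⇒nontrivialRelation L<t (λ i → xs i ∘ lookup L)
... | c , nontrivial , vanishes =
  c , nontrivial , λ u∈L → trans (cong (lincomb xs c) (lookup-index u∈L)) (vanishes (index u∈L))

lincomb-inEigenspace : (M : Fin n → Fin n → ℚ) (xs : Fin t → Fin n → ℚ) →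
                       (∀ i → InEigenspace-1 M (xs i)) → ∀ c → InEigenspace-1 M (lincomb xs c)
lincomb-inEigenspace {n} {t} M xs eigen c u = begin
  sumℚ (λ v → M u v * lincomb xs c v) + cx u
    ≡⟨ cong (_+ cx u) (sumℚ≡sum (λ v → M u v * cx v)) ⟩
  sum (λ v → M u v * sum (λ i → c i * xs i v)) + cx u
    ≡⟨ cong (_+ cx u) (sum-cong-≗ λ v → trans (*-distribˡ-sum (M u v) (λ i → c i * xs i v))
                        (sum-cong-≗ λ i → solve 3 (λ m a x → m :* (a :* x) := a :* (m :* x))
                                                  refl (M u v) (c i) (xs i v))) ⟩
  sum (λ v → sum (λ i → c i * (M u v * xs i v))) + cx u
    ≡⟨ cong (_+ cx u) (sym (∑-comm (λ i v → c i * (M u v * xs i v)))) ⟩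
  sum (λ i → sum (λ v → c i * (M u v * xs i v))) + cx u
    ≡⟨ cong (_+ cx u) (sum-cong-≗ λ i → sym (*-distribˡ-sum (c i) (λ v → M u v * xs i v))) ⟩
  sum (λ i → c i * Mx i) + cx u
    ≡⟨ sym (∑-distrib-+ (λ i → c i * Mx i) (λ i → c i * xs i u)) ⟩
  sum (λ i → c i * Mx i + c i * xs i u)
    ≡⟨ sum-cong-≗ (λ i → trans (sym (ℚ.*-distribˡ-+ (c i) _ _)) (cong (c i *_) (eigenᵢ i))) ⟩
  sum (λ i → c i * 0ℚ)
    ≡⟨ sum-cong-≗ (λ i → ℚ.*-zeroʳ (c i)) ⟩
  sum {t} (λ _ → 0ℚ)
    ≡⟨ sum-replicate-zero t ⟩
  0ℚ ∎
  where
  open ≡-Reasoning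
  open +-*-Solver
  cx : Fin n → ℚ
  cx = lincomb xs c
  Mx : Fin t → ℚ
  Mx i = sum (λ v → M u v * xs i v)
  eigenᵢ : ∀ i → Mx i + xs i u ≡ 0ℚ
  eigenᵢ i = trans (cong (_+ xs i u) (sym (sumℚ≡sum (λ v → M u v * xs i v)))) (eigen i u)

n<m^n : ∀ m n → 1 ℕ.< m → n ℕ.< m ^ n
n<m^n m@(suc _) zero    _   = ℕ.s≤s ℕ.z≤n
n<m^n m@(suc _) (suc n) 1<m = begin-strict
  suc n       ≤⟨ n<m^n m n 1<m ⟩
  m ^ n       <⟨ ℕ.m<m*n (m ^ n) m {{ℕ.m^n≢0 m n}} 1<m ⟩
  m ^ n ℕ.* m ≡⟨ ℕ.*-comm (m ^ n) m ⟩
  m ^ suc n   ∎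
  where open ℕ.≤-Reasoning

<∧∣⇒≡0 : ∀ {m n} → m ℕ.< n → n ℕ.∣ m → m ≡ 0
<∧∣⇒≡0 {zero}  _   _   = refl
<∧∣⇒≡0 {suc _} m<n n∣m = contradiction n∣m (ℕ.>⇒∤ m<n)

module _ (E : ℕ) (B : Fin n → Fin n → ℤ) (w : Fin n → ℤ)
         (fixed : ∀ u → w u ≡ ℤ.- (+ E ℤ.* ℤ∑.sum (λ v → B u v ℤ.* w v))) where

  powers-divide : ∀ j u → ∃ λ r → w u ≡ + (E ^ j) ℤ.* r
  powers-divide zero    u = w u , sym (ℤ.*-identityˡ (w u))
  powers-divide (suc j) u = ℤ.- Br , (begin
    w u                                                 ≡⟨ fixed u ⟩
    ℤ.- (+ E ℤ.* ℤ∑.sum (λ v → B u v ℤ.* w v))          ≡⟨ cong (λ s → ℤ.- (+ E ℤ.* s)) Bw≡Eʲ*Br ⟩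
    ℤ.- (+ E ℤ.* (+ (E ^ j) ℤ.* Br))                    ≡⟨ solve 3 (λ e p s → :- (e :* (p :* s)) := (e :* p) :* (:- s))
                                                                refl (+ E) (+ (E ^ j)) Br ⟩
    (+ E ℤ.* + (E ^ j)) ℤ.* ℤ.- Br                      ≡⟨ cong (ℤ._* ℤ.- Br) (sym (ℤ.pos-* E (E ^ j))) ⟩
    + (E ^ suc j) ℤ.* ℤ.- Br                            ∎)
    where
    open ≡-Reasoning
    open ℤ-Solver
    r : Fin n → ℤ
    r v = proj₁ (powers-divide j v)
    Br : ℤ
    Br = ℤ∑.sum (λ v → B u v ℤ.* r v)
    Bw≡Eʲ*Br : ℤ∑.sum (λ v → B u v ℤ.* w v) ≡ + (E ^ j) ℤ.* Br
    Bw≡Eʲ*Br = begin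
      ℤ∑.sum (λ v → B u v ℤ.* w v)
        ≡⟨ ℤ∑.sum-cong-≗ (λ v → trans (cong (B u v ℤ.*_) (proj₂ (powers-divide j v)))
                                       (solve 3 (λ b p x → b :* (p :* x) := p :* (b :* x)) refl (B u v) (+ (E ^ j)) (r v))) ⟩
      ℤ∑.sum (λ v → + (E ^ j) ℤ.* (B u v ℤ.* r v))
        ≡⟨ sym (ℤ∑.*-distribˡ-sum (+ (E ^ j)) (λ v → B u v ℤ.* r v)) ⟩
      + (E ^ j) ℤ.* Br ∎

  w≡-E·Bw⇒w≡0 : 1 ℕ.< E → ∀ u → w u ≡ 0ℤ
  w≡-E·Bw⇒w≡0 1<E u = ℤ.∣i∣≡0⇒i≡0 (<∧∣⇒≡0 (n<m^n E a 1<E) (ℕ.divides ℤ.∣ r ∣ a≡∣r∣*Eᵃ))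
    where
    a = ℤ.∣ w u ∣
    r = proj₁ (powers-divide a u)
    a≡∣r∣*Eᵃ : a ≡ ℤ.∣ r ∣ ℕ.* E ^ a
    a≡∣r∣*Eᵃ = trans (cong ℤ.∣_∣ (proj₂ (powers-divide a u)))
                     (trans (ℤ.abs-* (+ (E ^ a)) r) (ℕ.*-comm (E ^ a) ℤ.∣ r ∣))

fromℤ-pos-* : ∀ a b → fromℤ (+ (a ℕ.* b)) ≡ fromℤ (+ a) * fromℤ (+ b)
fromℤ-pos-* a b = trans (cong fromℤ (ℤ.pos-* a b)) (fromℤ-* (+ a) (+ b))

p*↧p≡↥p : ∀ p → p * fromℤ (+ ↧ₙ p) ≡ fromℤ (↥ p)
p*↧p≡↥p p@(ℚ.mkℚ a d-1 _) =
  ℚ.toℚᵘ-injective (ℚᵘ.≃-trans (ℚ.toℚᵘ-homo-* p (fromℤ (+ suc d-1))) (ℚᵘ.*≡* cross))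
  where
  cross : (a ℤ.* + suc d-1) ℤ.* + 1 ≡ a ℤ.* + (suc d-1 ℕ.* 1)
  cross = trans (ℤ.*-identityʳ _) (cong (λ d → a ℤ.* + d) (sym (ℕ.*-identityʳ (suc d-1))))

commonDenominator : (y : Fin n → ℚ) →
                    ∃₂ λ D (z : Fin n → ℤ) → ∀ u → y u * fromℤ (+ suc D) ≡ fromℤ (z u)
commonDenominator {zero}  y = 0 , (λ ()) , λ ()
commonDenominator {suc n} y with commonDenominator (y ∘ suc)
... | D , z , cleared = D ℕ.+ ℚ.denominator-1 y₀ ℕ.* suc D , z′ , cleared′
  where
  open ≡-Reasoning
  y₀ = y zero
  d₀ = ↧ₙ y₀
  z′ : Fin (suc n) → ℤ
  z′ zero    = ↥ y₀ ℤ.* + suc D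
  z′ (suc u) = z u ℤ.* + d₀
  cleared′ : ∀ u → y u * fromℤ (+ (d₀ ℕ.* suc D)) ≡ fromℤ (z′ u)
  cleared′ zero = begin
    y₀ * fromℤ (+ (d₀ ℕ.* suc D))              ≡⟨ cong (y₀ *_) (fromℤ-pos-* d₀ (suc D)) ⟩
    y₀ * (fromℤ (+ d₀) * fromℤ (+ suc D))      ≡⟨ sym (ℚ.*-assoc y₀ _ _) ⟩
    y₀ * fromℤ (+ d₀) * fromℤ (+ suc D)        ≡⟨ cong (_* fromℤ (+ suc D)) (p*↧p≡↥p y₀) ⟩
    fromℤ (↥ y₀) * fromℤ (+ suc D)             ≡⟨ sym (fromℤ-* (↥ y₀) (+ suc D)) ⟩
    fromℤ (↥ y₀ ℤ.* + suc D)                   ∎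
  cleared′ (suc u) = begin
    y (suc u) * fromℤ (+ (d₀ ℕ.* suc D))       ≡⟨ cong (y (suc u) *_) (trans (cong (λ d → fromℤ (+ d)) (ℕ.*-comm d₀ (suc D)))
                                                                              (fromℤ-pos-* (suc D) d₀)) ⟩
    y (suc u) * (fromℤ (+ suc D) * fromℤ (+ d₀)) ≡⟨ sym (ℚ.*-assoc (y (suc u)) _ _) ⟩
    y (suc u) * fromℤ (+ suc D) * fromℤ (+ d₀)   ≡⟨ cong (_* fromℤ (+ d₀)) (cleared u) ⟩
    fromℤ (z u) * fromℤ (+ d₀)                   ≡⟨ sym (fromℤ-* (z u) (+ d₀)) ⟩
    fromℤ (z u ℤ.* + d₀)                         ∎

p*q≡0⇒p≡0 : ∀ p q .{{_ : ℚ.NonZero q}} → p * q ≡ 0ℚ → p ≡ 0ℚ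
p*q≡0⇒p≡0 p q pq≡0 = begin
  p               ≡⟨ sym (ℚ.*-identityʳ p) ⟩
  p * 1ℚ          ≡⟨ cong (p *_) (sym (ℚ.*-inverseʳ q)) ⟩
  p * (q * 1/ q)  ≡⟨ sym (ℚ.*-assoc p q (1/ q)) ⟩
  p * q * 1/ q    ≡⟨ cong (_* 1/ q) pq≡0 ⟩
  0ℚ * 1/ q       ≡⟨ ℚ.*-zeroˡ (1/ q) ⟩
  0ℚ              ∎
  where open ≡-Reasoning

y≡-E·By⇒y≡0 : (E : ℕ) → 1 ℕ.< E → (B : Fin n → Fin n → ℤ) (y : Fin n → ℚ) →
              (∀ u → y u ≡ - (fromℤ (+ E) * sum (λ v → fromℤ (B u v) * y v))) →
              ∀ u → y u ≡ 0ℚ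
y≡-E·By⇒y≡0 E 1<E B y fixed u with commonDenominator y
... | D , z , cleared =
  p*q≡0⇒p≡0 (y u) δ (trans (cleared u) (cong fromℤ (w≡-E·Bw⇒w≡0 E B z z-fixed 1<E u)))
  where
  open ≡-Reasoning
  open +-*-Solver
  δ = fromℤ (+ suc D)
  ε = fromℤ (+ E)
  z-fixed : ∀ u → z u ≡ ℤ.- (+ E ℤ.* ℤ∑.sum (λ v → B u v ℤ.* z v))
  z-fixed u = fromℤ-injective (begin
    fromℤ (z u)                                           ≡⟨ sym (cleared u) ⟩
    y u * δ                                               ≡⟨ cong (_* δ) (fixed u) ⟩
    - (ε * By) * δ                                        ≡⟨ solve 3 (λ e s d → (:- (e :* s)) :* d := :- (e :* (d :* s)))
                                                                   refl ε By δ ⟩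
    - (ε * (δ * By))                                      ≡⟨ cong (λ s → - (ε * s)) (*-distribˡ-sum δ (λ v → fromℤ (B u v) * y v)) ⟩
    - (ε * sum (λ v → δ * (fromℤ (B u v) * y v)))         ≡⟨ cong (λ s → - (ε * s)) (sum-cong-≗ λ v →
                                                               solve 3 (λ d b x → d :* (b :* x) := b :* (x :* d)) refl δ (fromℤ (B u v)) (y v)) ⟩
    - (ε * sum (λ v → fromℤ (B u v) * (y v * δ)))         ≡⟨ cong (λ s → - (ε * s)) (sum-cong-≗ λ v → cong (fromℤ (B u v) *_) (cleared v)) ⟩
    - (ε * sum (λ v → fromℤ (B u v) * fromℤ (z v)))       ≡⟨ cong (λ s → - (ε * s)) (sym (trans (fromℤ-sum (λ v → B u v ℤ.* z v))
                                                                                            (sum-cong-≗ λ v → fromℤ-* (B u v) (z v)))) ⟩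
    - (ε * fromℤ (ℤ∑.sum (λ v → B u v ℤ.* z v)))          ≡⟨ cong -_ (sym (fromℤ-* (+ E) _)) ⟩
    - fromℤ (+ E ℤ.* ℤ∑.sum (λ v → B u v ℤ.* z v))        ≡⟨ sym (fromℤ-neg _) ⟩
    fromℤ (ℤ.- (+ E ℤ.* ℤ∑.sum (λ v → B u v ℤ.* z v)))    ∎)
    where
    By = sum (λ v → fromℤ (B u v) * y v)

module _ {A : Set} (f : A → ℕ) where

  f≤foldr-⊔ : ∀ {x xs} → x ∈ xs → f x ℕ.≤ foldr (λ w m → f w ⊔ m) 0 xs
  f≤foldr-⊔ (here refl) = ℕ.m≤m⊔n _ _
  f≤foldr-⊔ {xs = y ∷ _} (there x∈xs) = ℕ.≤-trans (f≤foldr-⊔ x∈xs) (ℕ.m≤n⊔m (f y) _)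

t+s≤n⇒t≤n-k-1 : ∀ {t s n} k → t ℕ.+ s ℕ.≤ n → k ℤ.+ + 1 ℤ.≤ + s → + t ℤ.≤ + n ℤ.- k ℤ.- + 1
t+s≤n⇒t≤n-k-1 {t} {s} {n} k t+s≤n k+1≤s = begin
  + t                                 ≡⟨ solve 2 (λ a b → a := (a :+ b) :- b) refl (+ t) (k ℤ.+ + 1) ⟩
  + t ℤ.+ (k ℤ.+ + 1) ℤ.- (k ℤ.+ + 1) ≤⟨ ℤ.+-monoˡ-≤ (ℤ.- (k ℤ.+ + 1)) t+k+1≤n ⟩
  + n ℤ.- (k ℤ.+ + 1)                 ≡⟨ solve 2 (λ a b → a :- (b :+ con (+ 1)) := a :- b :- con (+ 1)) refl (+ n) k ⟩
  + n ℤ.- k ℤ.- + 1                   ∎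
  where
  open ℤ.≤-Reasoning
  open ℤ-Solver
  t+k+1≤n : + t ℤ.+ (k ℤ.+ + 1) ℤ.≤ + n
  t+k+1≤n = ℤ.≤-trans (ℤ.+-monoʳ-≤ (+ t) k+1≤s) (ℤ.+≤+ t+s≤n)

count : {A : Set} → (A → ℕ) → ℕ → List A → ℕ
count f e xs = length (filter (λ x → f x ≟ e) xs)

length-filter+length-filter-¬ : ∀ {p} {A : Set} {P : Pred A p} (P? : Decidable P) (xs : List A) →
                                length (filter P? xs) ℕ.+ length (filter (¬? ∘ P?) xs) ≡ length xs
length-filter+length-filter-¬ P? []       = refl
length-filter+length-filter-¬ P? (x ∷ xs) with P? x
... | yes _ = cong suc (length-filter+length-filter-¬ P? xs)
... | no _  = trans (ℕ.+-suc _ _) (cong suc (length-filter+length-filter-¬ P? xs))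

count-filter≤count : ∀ {q} {A : Set} (f : A → ℕ) (e : ℕ) {Q : Pred A q} (Q? : Decidable Q) (xs : List A) →
                     count f e (filter Q? xs) ℕ.≤ count f e xs
count-filter≤count f e Q? xs = length-mono-≤ (filter⁺ P? P? (λ { refl p → p }) (filter-⊆ Q? xs))
  where
  P? = λ x → f x ≟ e

pigeonhole : {A : Set} (f : A → ℕ) (k a m : ℕ) (xs : List A) →
             (∀ {x} → x ∈ xs → a ℕ.≤ f x × f x ℕ.< a ℕ.+ m) → k ℕ.* m ℕ.< length xs →
             ∃ λ e → a ℕ.≤ e × k ℕ.< count f e xs
pigeonhole f k a zero    (x ∷ _) inRange _ with inRange (here refl)
... | a≤fx , fx<a+0 = contradiction (ℕ.<-≤-trans fx<a+0 (ℕ.≤-reflexive (ℕ.+-identityʳ a))) (ℕ.≤⇒≯ a≤fx)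
pigeonhole f k a (suc m) xs inRange km<len with k ℕ.<? count f (a ℕ.+ m) xs
... | yes k<count = a ℕ.+ m , ℕ.m≤m+n a m , k<count
... | no k≮count with pigeonhole f k a m rest restInRange km<rest
  where
  top = a ℕ.+ m
  rest = filter (λ x → ¬? (f x ≟ top)) xs
  restInRange : ∀ {x} → x ∈ rest → a ℕ.≤ f x × f x ℕ.< a ℕ.+ m
  restInRange x∈rest with ∈-filter⁻ (λ x → ¬? (f x ≟ top)) x∈rest
  ... | x∈xs , fx≢top with inRange x∈xs
  ...   | a≤fx , fx<top+1 =
    a≤fx , ℕ.≤∧≢⇒< (ℕ.≤-pred (ℕ.<-≤-trans fx<top+1 (ℕ.≤-reflexive (ℕ.+-suc a m)))) fx≢top
  km<rest : k ℕ.* m ℕ.< length rest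
  km<rest = ℕ.+-cancelˡ-< k _ _ (begin-strict
    k ℕ.+ k ℕ.* m                  ≡⟨ ℕ.*-suc k m ⟨
    k ℕ.* suc m                    <⟨ km<len ⟩
    length xs                      ≡⟨ length-filter+length-filter-¬ (λ x → f x ≟ top) xs ⟨
    count f top xs ℕ.+ length rest ≤⟨ ℕ.+-monoˡ-≤ (length rest) (ℕ.≮⇒≥ k≮count) ⟩
    k ℕ.+ length rest              ∎)
    where open ℕ.≤-Reasoning
... | e , a≤e , k<count = e , a≤e , ℕ.<-≤-trans k<count (count-filter≤count f e _ xs)

-- The walk length 0 counts towards dist u v when u ≢ v.
dist≥1 : ∀ {n} (G : Graph n) {u v} → u ≢ v → 1 ℕ.≤ dist G u v
dist≥1 {suc _} G {u} {v} u≢v with u Fin.≟ v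
... | yes u≡v = contradiction u≡v u≢v
... | no _    = ℕ.s≤s ℕ.z≤n

module _ {n : ℕ} (G : Graph n) where

  ≤maxOver : (f : Fin n → ℕ) (u : Fin n) → f u ℕ.≤ maxOver G f
  ≤maxOver f u = f≤foldr-⊔ f (∈-allFin u)

  dist≤ecc : ∀ u v → dist G u v ℕ.≤ ecc G v
  dist≤ecc u v = ≤maxOver (λ w → dist G w v) u

  ecc≤diameter : ∀ v → ecc G v ℕ.≤ diameter G
  ecc≤diameter = ≤maxOver (ecc G)

  eccClassSize : ℕ → ℕ
  eccClassSize e = count (ecc G) e (allFin n)

  ecc≥2 : 2 ℕ.≤ n → ∀ v → ecc G v ≢ 1 → 2 ℕ.≤ ecc G v
  ecc≥2 (ℕ.s≤s (ℕ.s≤s _)) v ecc≢1 = ℕ.≤∧≢⇒< 1≤ecc (ecc≢1 ∘ sym)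
    where
    1≤ecc : 1 ℕ.≤ ecc G v
    1≤ecc = ℕ.≤-trans (dist≥1 G (punchInᵢ≢i v zero)) (dist≤ecc (punchIn v zero) v)

  -- On Vₑ × Vₑ the eccentricity matrix is e times this 0/1 matrix.
  eccPattern : ℕ → Fin n → Fin n → ℤ
  eccPattern e u v with ecc G u ≟ e | dist G u v ≟ ecc G u ⊓ ecc G v
  ... | yes _ | yes _ = + 1
  ... | _     | _     = 0ℤ

  eccPattern-outside : ∀ {e u} v → ecc G u ≢ e → eccPattern e u v ≡ 0ℤ
  eccPattern-outside {e} {u} v ¬eᵤ with ecc G u ≟ e
  ... | yes eᵤ = contradiction eᵤ ¬eᵤ
  ... | no _   = refl

  eccMatrix≡e*eccPattern : ∀ {e u v} → ecc G u ≡ e → ecc G v ≡ e →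
                           eccMatrix G u v ≡ fromℤ (+ e) * fromℤ (eccPattern e u v)
  eccMatrix≡e*eccPattern {e} {u} {v} eᵤ eᵥ with ecc G u ≟ e | dist G u v ≟ ecc G u ⊓ ecc G v
  ... | no ¬eᵤ | _      = contradiction eᵤ ¬eᵤ
  ... | yes _  | no _   = sym (ℚ.*-zeroʳ (fromℤ (+ e)))
  ... | yes _  | yes d≡ = trans (ℚ.↥p/↧p≡p (fromℤ (+ dist G u v)))
                                (trans (cong (λ d → fromℤ (+ d)) d≡e) (sym (ℚ.*-identityʳ (fromℤ (+ e)))))
    where
    d≡e : dist G u v ≡ e
    d≡e = trans d≡ (trans (cong₂ _⊓_ eᵤ eᵥ) (ℕ.⊓-idem e))

  supported-eigenvector-fixed : ∀ {e} {y : Fin n → ℚ} → InEigenspace-1 (eccMatrix G) y →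
                                (∀ u → ecc G u ≢ e → y u ≡ 0ℚ) →
                                ∀ u → y u ≡ - (fromℤ (+ e) * sum (λ v → fromℤ (eccPattern e u v) * y v))
  supported-eigenvector-fixed {e} {y} eigen outside u = fixed (ecc G u ≟ e)
    where
    open ≡-Reasoning
    ε = fromℤ (+ e)
    Pᵤ = λ v → fromℤ (eccPattern e u v)

    fixed : Dec (ecc G u ≡ e) → y u ≡ - (ε * sum (λ v → Pᵤ v * y v))
    fixed (no ¬eᵤ) = begin
      y u                               ≡⟨ outside u ¬eᵤ ⟩
      0ℚ                                ≡⟨ cong -_ (ℚ.*-zeroʳ ε) ⟨
      - (ε * 0ℚ)                        ≡⟨ cong (λ s → - (ε * s)) (sum-replicate-zero n) ⟨
      - (ε * sum {n} (λ _ → 0ℚ))        ≡⟨ cong (λ s → - (ε * s)) (sum-cong-≗ λ v →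
                                             trans (cong (λ b → fromℤ b * y v) (eccPattern-outside v ¬eᵤ)) (ℚ.*-zeroˡ (y v))) ⟨
      - (ε * sum (λ v → Pᵤ v * y v))    ∎
    fixed (yes eᵤ) = begin
      y u                                       ≡⟨ GroupProperties.inverseʳ-unique ℚ.+-0-group _ (y u) (eigen u) ⟩
      - sumℚ (λ v → eccMatrix G u v * y v)      ≡⟨ cong -_ (sumℚ≡sum (λ v → eccMatrix G u v * y v)) ⟩
      - sum (λ v → eccMatrix G u v * y v)       ≡⟨ cong -_ (sum-cong-≗ term) ⟩
      - sum (λ v → ε * (Pᵤ v * y v))            ≡⟨ cong -_ (*-distribˡ-sum ε (λ v → Pᵤ v * y v)) ⟨
      - (ε * sum (λ v → Pᵤ v * y v))            ∎
      where
      term : ∀ v → eccMatrix G u v * y v ≡ ε * (Pᵤ v * y v)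
      term v with ecc G v ≟ e
      ... | yes eᵥ = trans (cong (_* y v) (eccMatrix≡e*eccPattern eᵤ eᵥ)) (ℚ.*-assoc ε (Pᵤ v) (y v))
      ... | no ¬eᵥ rewrite outside v ¬eᵥ =
        trans (ℚ.*-zeroʳ (eccMatrix G u v)) (sym (trans (cong (ε *_) (ℚ.*-zeroʳ (Pᵤ v))) (ℚ.*-zeroʳ ε)))

  supported-eigenvector≡0 : ∀ {e} {y : Fin n → ℚ} → 2 ℕ.≤ e → InEigenspace-1 (eccMatrix G) y →
                            (∀ u → ecc G u ≢ e → y u ≡ 0ℚ) → ∀ u → y u ≡ 0ℚ
  supported-eigenvector≡0 {e} {y} 2≤e eigen outside =
    y≡-E·By⇒y≡0 e 2≤e (eccPattern e) y (supported-eigenvector-fixed eigen outside)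

  t+eccClassSize≤n : ∀ {e t} → 2 ℕ.≤ e → Eig-1-Independent (eccMatrix G) t → t ℕ.+ eccClassSize e ℕ.≤ n
  t+eccClassSize≤n {e} {t} 2≤e (xs , independent , eigen) with t ℕ.+ eccClassSize e ℕ.≤? n
  ... | yes bound = bound
  ... | no ¬bound with nontrivialRelationOn others others<t xs
    where
    others = filter (λ u → ¬? (ecc G u ≟ e)) (allFin n)
    others<t : length others ℕ.< t
    others<t = ℕ.+-cancelˡ-< (eccClassSize e) _ _ (begin-strict
      eccClassSize e ℕ.+ length others ≡⟨ length-filter+length-filter-¬ (λ u → ecc G u ≟ e) (allFin n) ⟩
      length (allFin n)                 ≡⟨ List.length-tabulate id ⟩
      n                                 <⟨ ℕ.≰⇒> ¬bound ⟩
      t ℕ.+ eccClassSize e              ≡⟨ ℕ.+-comm t _ ⟩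
      eccClassSize e ℕ.+ t              ∎)
      where open ℕ.≤-Reasoning
  ... | c , (i , cᵢ≢0) , vanishes =
    contradiction (independent c (λ u → trans (sumℚ≡sum (λ j → c j * xs j u)) (y≡0 u)) i) cᵢ≢0
    where
    y≡0 : ∀ u → lincomb xs c u ≡ 0ℚ
    y≡0 = supported-eigenvector≡0 2≤e (lincomb-inEigenspace (eccMatrix G) xs eigen c)
            (λ u ¬eᵤ → vanishes (∈-filter⁺ (λ u → ¬? (ecc G u ≟ e)) (∈-allFin u) ¬eᵤ))

  large-eccentricity-class : Fin n → (∀ v → 2 ℕ.≤ ecc G v) → ∀ k →
                             k ℤ.* (+ diameter G ℤ.- + 1) ℤ.+ + 1 ℤ.≤ + n →
                             ∃ λ e → 2 ℕ.≤ e × k ℤ.+ + 1 ℤ.≤ + eccClassSize e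
  large-eccentricity-class v₀ ecc≥2 ℤ.-[1+ k ] _ =
    ecc G v₀ , ecc≥2 v₀ , ℤ.≤-trans (ℤ.+-monoˡ-≤ (+ 1) (ℤ.-≤- {k} ℕ.z≤n)) (ℤ.+≤+ ℕ.z≤n)
  large-eccentricity-class v₀ ecc≥2 (+ k) k[d-1]+1≤n
    with pigeonhole (ecc G) k 2 (d ℕ.∸ 1) (allFin n) inRange k[d-1]<n
    where
    d = diameter G
    1≤d : 1 ℕ.≤ d
    1≤d = ℕ.≤-trans (ℕ.s≤s ℕ.z≤n) (ℕ.≤-trans (ecc≥2 v₀) (ecc≤diameter v₀))
    inRange : ∀ {v} → v ∈ allFin n → 2 ℕ.≤ ecc G v × ecc G v ℕ.< 2 ℕ.+ (d ℕ.∸ 1)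
    inRange {v} _ = ecc≥2 v , ℕ.s≤s (ℕ.≤-trans (ecc≤diameter v) (ℕ.≤-reflexive (sym (ℕ.m+[n∸m]≡n 1≤d))))
    k[d-1]<n : k ℕ.* (d ℕ.∸ 1) ℕ.< length (allFin n)
    k[d-1]<n = ℕ.≤-trans (ℕ.≤-reflexive (ℕ.+-comm 1 _))
                 (ℕ.≤-trans (ℤ.drop‿+≤+ (subst (ℤ._≤ + n) +k[d-1]+1 k[d-1]+1≤n))
                            (ℕ.≤-reflexive (sym (List.length-tabulate id))))
      where
      +k[d-1]+1 : + k ℤ.* (+ d ℤ.- + 1) ℤ.+ + 1 ≡ + (k ℕ.* (d ℕ.∸ 1) ℕ.+ 1)
      +k[d-1]+1 = trans (cong (λ i → + k ℤ.* i ℤ.+ + 1) (trans (ℤ.m-n≡m⊖n d 1) (ℤ.⊖-≥ 1≤d)))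
                        (cong (λ i → i ℤ.+ + 1) (sym (ℤ.pos-* k (d ℕ.∸ 1))))
  ... | e , 2≤e , k<size = e , 2≤e , ℤ.+≤+ (ℕ.≤-trans (ℕ.≤-reflexive (ℕ.+-comm k 1)) k<size)

lemma3p4 : (n : ℕ) → n ℕ.≥ 2 → (G : Graph n) → Connected G → (k : ℤ)
    → (∀ v → ecc G v ≢ 1)
    → + n ℤ.≥ k ℤ.* (+ diameter G ℤ.- + 1) ℤ.+ + 1
    → ∀ t → Eig-1-Independent (eccMatrix G) t
    → + t ℤ.≤ + n ℤ.- k ℤ.- + 1
lemma3p4 (suc n) n≥2 G _ k ecc≢1 n≥k[d-1]+1 t independent
  with large-eccentricity-class G zero (λ v → ecc≥2 G n≥2 v (ecc≢1 v)) k n≥k[d-1]+1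
... | e , 2≤e , k+1≤size = t+s≤n⇒t≤n-k-1 k (t+eccClassSize≤n G 2≤e independent) k+1≤size
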